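{- Let $r\in\{\beta,\beta\eta,h\}$. For types in $\mathbb U$: (1) $[\overline e_iU]_r=[U]_r^{+i}$; (2) $[U\sqcap V]_r=[U]_r\cap[V]_r$ (for $U,V$ with $d(U)=d(V)$); (3) if $\mathcal I$ is an $r$-interpretation and $U,V\in\mathbb U$, then $\mathcal I(U)\wr\mathcal I(V)$.
   Context: Indexes: finite sequences of natural numbers ($\mathcal L_{\mathbb N}$), $\oslash$ empty, $i::L$ prepending $i$, $L_1\preceq L_2$ (also $L_2\succeq L_1$) iff $L_2=L_1::L_3$ for some $L_3$ (concatenation). Terms: over a countably infinite set $\mathcal V=\mathcal V_1\cup\mathcal V_2$ ($\mathcal V_1,\mathcal V_2$ disjoint and countably infinite), terms $\mathcal M$, free indexed variables $\mathrm{fv}$, degree $d$, joinability $\diamond$ defined simultaneously: $x^L\in\mathcal M$ ($\mathrm{fv}=\{x^L\}$, $d=L$); $MN\in\mathcal M$ when $d(M)\preceq d(N)$, $M\diamond N$ ($\mathrm{fv}$ union, $d(MN)=d(M)$); $\lambda x^L.M\in\mathcal M$ when $L\succeq d(M)$ ($\mathrm{fv}(M)\setminus\{x^L\}$, $d=d(M)$). $M\diamond N$ iff $x^L\in\mathrm{fv}(M)$, $x^K\in\mathrm{fv}(N)$ imply $L=K$. Terms modulo $\alpha$; $M[x^L:=N]$ defined only if $M\diamond N$, $d(N)=L$. Closed: $\mathrm{fv}(M)=\emptyset$. $\rhd_\beta$: least relation compatible with abstraction and application containing $(\lambda x^L.M)N\rhd_\beta M[x^L:=N]$ ($d(N)=L$);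 $\rhd_\eta$: from $\lambda x^L.(Mx^L)\rhd_\eta M$ ($x^L\notin\mathrm{fv}(M)$); $\rhd_{\beta\eta}=\rhd_\beta\cup\rhd_\eta$; $(\lambda x^L.M)NN_1\dots N_n\rhd_hM[x^L:=N]N_1\dots N_n$; $\rhd^*_r$ reflexive–transitive closure. Lifting $(x^L)^{+i}=x^{i::L}$, $(M_1M_2)^{+i}=M_1^{+i}M_2^{+i}$, $(\lambda x^L.M)^{+i}=\lambda x^{i::L}.M^{+i}$. Types: atomic types $\mathcal A$, expansion variables $\overline e_0,\overline e_1,\dots$; $\mathbb T\subseteq\mathbb U$ with degree: $a\in\mathbb T$ ($d=\oslash$); $U\to T\in\mathbb T$ for $U\in\mathbb U,T\in\mathbb T$ ($d=\oslash$); $\omega^L\in\mathbb U$ ($d=L$); $U_1\sqcap U_2$ if $d(U_1)=d(U_2)$; $\overline e_iU$ ($d=i::d(U)$); modulo $\sqcap$ commutative, associative, idempotent, $\overline e_i(U_1\sqcap U_2)=\overline e_iU_1\sqcap\overline e_iU_2$, $\omega^L\sqcap U=U$ ($d(U)=L$), $\overline e_i\omega^K=\omega^{i::K}$. Realisability: for sets of terms, $\mathcal X^{+i}=\{M^{+i}:M\in\mathcal X\}$; $\mathcal X\leadsto\mathcal Y=\{M\in\mathcal M: MN\in\mathcal Y$ for all $N\in\mathcal X$ with $M\diamond N\}$; $\mathcal X\wr\mathcal Y$ iff for every $M\in\mathcal X\leadsto\mathcal Y$ there exists $N\in\mathcal X$ with $M\diamond N$; $\mathcal X$ is $r$-saturated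 if $M\rhd^*_rN\in\mathcal X$ implies $M\in\mathcal X$. $\mathcal M^L=\{M:d(M)=L\}$; for $x\in\mathcal V_1$, $\mathcal N^L_x=\{x^LN_1\dots N_k\in\mathcal M:k\ge0\}$. An $r$-interpretation is $\mathcal I:\mathcal A\to\mathcal P(\mathcal M^\oslash)$ with each $\mathcal I(a)$ $r$-saturated and containing $\mathcal N^\oslash_x$ for all $x\in\mathcal V_1$, extended to $\mathbb U$ by $\mathcal I(\omega^L)=\mathcal M^L$, $\mathcal I(\overline e_iU)=\mathcal I(U)^{+i}$, $\mathcal I(U_1\sqcap U_2)=\mathcal I(U_1)\cap\mathcal I(U_2)$, $\mathcal I(U\to T)=\mathcal I(U)\leadsto\mathcal I(T)$. $[U]_r=\{M\in\mathcal M: M$ closed and $M\in\mathcal I(U)$ for every $r$-interpretation $\mathcal I\}$. -}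

module Defs where

open import Data.Nat using (ℕ; zero; suc; _<_; _<ᵇ_; _≡ᵇ_; pred)
open import Data.Bool using (if_then_else_)
open import Data.List using (List; []; _∷_; _++_; length; foldl)
open import Data.Product using (Σ; _×_; _,_; ∃)
open import Data.Sum using (_⊎_)
open import Data.Empty using (⊥)
open import Level using (Level; _⊔_) renaming (suc to lsuc)
open import Relation.Nullary using (¬_)
open import Relation.Binary.PropositionalEquality using (_≡_)
open import Relation.Binary.Construct.Closure.ReflexiveTransitive using (Star)
open import Relation.Unary using (Pred; _∩_)

Index : Set
Index = List ℕ

_⪯_ : Index → Index → Set
L₁ ⪯ L₂ = Σ Index λ L₃ → L₂ ≡ L₁ ++ L₃

data Var : Set where
  v₁ : ℕ → Var
  v₂ : ℕ → Var

data InV₁ : Var → Set where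
  inV₁ : ∀ n → InV₁ (v₁ n)

-- Raw terms, locally nameless: bound variables are de Bruijn indices
-- (so α-equivalent terms are syntactically equal), free variables are
-- indexed variables x^L. The index of a bound variable is the index
-- carried by its binder.

data Tm : Set where
  bv  : ℕ → Tm
  fv  : Var → Index → Tm
  _·_ : Tm → Tm → Tm
  ƛ   : Index → Tm → Tm

infixl 7 _·_

apps : Tm → List Tm → Tm
apps = foldl _·_

data FV : Tm → Var → Index → Set where
  fv-var : ∀ {x L} → FV (fv x L) x L
  fv-appˡ : ∀ {M N x L} → FV M x L → FV (M · N) x L
  fv-appʳ : ∀ {M N x L} → FV N x L → FV (M · N) x L
  fv-lam : ∀ {K M x L} → FV M x L → FV (ƛ K M) x L

_⋄_ : Tm → Tm → Set
M ⋄ N = ∀ x L K → FV M x L → FV N x K → L ≡ K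

Closed : Tm → Set
Closed M = ∀ x L → ¬ FV M x L

-- degree, relative to the indexes Γ of the enclosing binders
lookupD : List Index → ℕ → Index
lookupD []      _       = []
lookupD (L ∷ Γ) zero    = L
lookupD (L ∷ Γ) (suc i) = lookupD Γ i

deg : List Index → Tm → Index
deg Γ (bv i)   = lookupD Γ i
deg Γ (fv x L) = L
deg Γ (M · N)  = deg Γ M
deg Γ (ƛ L M)  = deg (L ∷ Γ) M

-- well-formed terms (the set 𝓜 is  Wf [] )
data Wf (Γ : List Index) : Tm → Set where
  wf-bv  : ∀ {i} → i < length Γ → Wf Γ (bv i)
  wf-fv  : ∀ {x L} → Wf Γ (fv x L)
  wf-app : ∀ {M N} → Wf Γ M → Wf Γ N → deg Γ M ⪯ deg Γ N → M ⋄ N →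
           Wf Γ (M · N)
  wf-lam : ∀ {L M} → Wf (L ∷ Γ) M → deg (L ∷ Γ) M ⪯ L → Wf Γ (ƛ L M)

𝓜^ : Index → Pred Tm Level.zero
𝓜^ L M = Wf [] M × deg [] M ≡ L

lift : ℕ → Tm → Tm
lift i (bv n)   = bv n
lift i (fv x L) = fv x (i ∷ L)
lift i (M · N)  = lift i M · lift i N
lift i (ƛ L M)  = ƛ (i ∷ L) (lift i M)

shift : ℕ → Tm → Tm
shift c (bv i)   = if i <ᵇ c then bv i else bv (suc i)
shift c (fv x L) = fv x L
shift c (M · N)  = shift c M · shift c N
shift c (ƛ L M)  = ƛ L (shift (suc c) M)

subst : ℕ → Tm → Tm → Tm
subst k N (bv i)   = if i <ᵇ k then bv i else (if i ≡ᵇ k then N else bv (pred i))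
subst k N (fv x L) = fv x L
subst k N (M · P)  = subst k N M · subst k N P
subst k N (ƛ L M)  = ƛ L (subst (suc k) (shift 0 N) M)

infix 4 _⊢_▷β_ _⊢_▷η_ _▷h_ _⊢_▷*_

data _⊢_▷β_ : List Index → Tm → Tm → Set where
  β-red : ∀ {Γ L M N} → deg Γ N ≡ L → Γ ⊢ (ƛ L M) · N ▷β subst 0 N M
  β-appˡ : ∀ {Γ M M' N} → Γ ⊢ M ▷β M' → Γ ⊢ M · N ▷β M' · N
  β-appʳ : ∀ {Γ M N N'} → Γ ⊢ N ▷β N' → Γ ⊢ M · N ▷β M · N'
  β-lam : ∀ {Γ L M M'} → (L ∷ Γ) ⊢ M ▷β M' → Γ ⊢ ƛ L M ▷β ƛ L M'

data _⊢_▷η_ : List Index → Tm → Tm → Set where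
  η-red : ∀ {Γ L M} → Γ ⊢ ƛ L (shift 0 M · bv 0) ▷η M
  η-appˡ : ∀ {Γ M M' N} → Γ ⊢ M ▷η M' → Γ ⊢ M · N ▷η M' · N
  η-appʳ : ∀ {Γ M N N'} → Γ ⊢ N ▷η N' → Γ ⊢ M · N ▷η M · N'
  η-lam : ∀ {Γ L M M'} → (L ∷ Γ) ⊢ M ▷η M' → Γ ⊢ ƛ L M ▷η ƛ L M'

data _▷h_ : Tm → Tm → Set where
  h-red : ∀ {L M N Ns} → deg [] N ≡ L →
          apps (ƛ L M · N) Ns ▷h apps (subst 0 N M) Ns

data Red : Set where
  β βη h : Red

Step : Red → Tm → Tm → Set
Step β  M N = [] ⊢ M ▷β N
Step βη M N = ([] ⊢ M ▷β N) ⊎ ([] ⊢ M ▷η N)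
Step h  M N = M ▷h N

_⊢_▷*_ : Red → Tm → Tm → Set
r ⊢ M ▷* N = Star (Step r) M N

_⁺_ : ∀ {ℓ} → Pred Tm ℓ → ℕ → Pred Tm ℓ
(X ⁺ i) N = Σ Tm λ M → X M × N ≡ lift i M

_⇝_ : ∀ {ℓ₁ ℓ₂} → Pred Tm ℓ₁ → Pred Tm ℓ₂ → Pred Tm (ℓ₁ ⊔ ℓ₂)
(X ⇝ Y) M = Wf [] M × (∀ N → X N → M ⋄ N → Y (M · N))

_≀_ : ∀ {ℓ₁ ℓ₂} → Pred Tm ℓ₁ → Pred Tm ℓ₂ → Set (ℓ₁ ⊔ ℓ₂)
X ≀ Y = ∀ M → (X ⇝ Y) M → Σ Tm λ N → X N × M ⋄ N

Saturated : ∀ {ℓ} → Red → Pred Tm ℓ → Set ℓ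
Saturated r X = ∀ M N → Wf [] M → r ⊢ M ▷* N → X N → X M

𝓝 : Index → Var → Pred Tm Level.zero
𝓝 L x M = Σ (List Tm) λ Ns → M ≡ apps (fv x L) Ns × Wf [] M

-- Types (raw syntax; the equational theory is respected by ⟦_⟧)

data Ty (𝒜 : Set) : Set where
  atom : 𝒜 → Ty 𝒜
  _⇒_  : Ty 𝒜 → Ty 𝒜 → Ty 𝒜
  ω    : Index → Ty 𝒜
  _⊓_  : Ty 𝒜 → Ty 𝒜 → Ty 𝒜
  ē    : ℕ → Ty 𝒜 → Ty 𝒜

dT : ∀ {𝒜} → Ty 𝒜 → Index
dT (atom a) = []
dT (U ⇒ T)  = []
dT (ω L)    = L
dT (U ⊓ V)  = dT U
dT (ē i U)  = i ∷ dT U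

mutual
  data IsT {𝒜 : Set} : Ty 𝒜 → Set where
    t-atom : ∀ a → IsT (atom a)
    t-arr  : ∀ {U T} → IsU U → IsT T → IsT (U ⇒ T)

  data IsU {𝒜 : Set} : Ty 𝒜 → Set where
    u-T   : ∀ {T} → IsT T → IsU T
    u-ω   : ∀ L → IsU (ω L)
    u-⊓   : ∀ {U V} → IsU U → IsU V → dT U ≡ dT V → IsU (U ⊓ V)
    u-ē   : ∀ {i U} → IsU U → IsU (ē i U)

record Interp (𝒜 : Set) (r : Red) : Set₁ where
  field
    I      : 𝒜 → Pred Tm Level.zero
    I⊆𝓜∅   : ∀ a M → I a M → 𝓜^ [] M
    I-sat  : ∀ a → Saturated r (I a)
    I-neut : ∀ a x → InV₁ x → ∀ M → 𝓝 [] x M → I a M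

⟦_⟧ : ∀ {𝒜 r} → Ty 𝒜 → Interp 𝒜 r → Pred Tm Level.zero
⟦ atom a ⟧ ℐ = Interp.I ℐ a
⟦ U ⇒ T ⟧  ℐ = ⟦ U ⟧ ℐ ⇝ ⟦ T ⟧ ℐ
⟦ ω L ⟧    ℐ = 𝓜^ L
⟦ U ⊓ V ⟧  ℐ = ⟦ U ⟧ ℐ ∩ ⟦ V ⟧ ℐ
⟦ ē i U ⟧  ℐ = ⟦ U ⟧ ℐ ⁺ i

[_]_ : ∀ {𝒜} → Ty 𝒜 → Red → Pred Tm (lsuc Level.zero)
([ U ] r) M = Wf [] M × Closed M × (∀ (ℐ : Interp _ r) → ⟦ U ⟧ ℐ M)

-- Part (2) is a pointwise rearrangement of the definition of [U]_r.  In
-- part (1), [U]_r^{+i} ⊆ [e_i U]_r is immediate.  Conversely, M ∈ [e_i U]_r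
-- is a lift M'^{+i} with M' ∈ 𝓘(U) for every interpretation 𝓘; to get M'
-- at all we use the degree interpretation (every atom ↦ 𝓜^∅), which is
-- r-saturated because reductions preserve degrees.  Lifting is injective,
-- so M' is the same for every 𝓘, and lifting reflects well-formedness and
-- closedness, so M' ∈ [U]_r.  Part (3): 𝓘(U) contains x^{d(U)} for every
-- x ∈ 𝒱₁ (𝕋-types even contain every well-formed neutral x^∅ N₁…Nₖ), and a
-- variable of 𝒱₁ not occurring in a term M is joinable with M.
module Submission where

open import Defs
open import Data.Product using (_×_)
open import Relation.Binary.PropositionalEquality using (_≡_)
open import Relation.Unary using (_≐_; _∩_)

open import Data.Nat using (ℕ; zero; suc; _<_; _<ᵇ_; _≡ᵇ_; pred; _≤_; _⊔_; s≤s)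
open import Data.Nat.Properties
  using (≤-trans; ≤-refl; m≤m⊔n; m≤n⊔m; n≮n; ≮⇒≥; ≤∧≢⇒<; <ᵇ-reflects-<; ≡ᵇ⇒≡; ≡⇒≡ᵇ)
open import Data.List using (List; []; _∷_; _++_; length; map; drop)
open import Data.List.Properties using (length-map; ∷-injectiveʳ)
open import Data.Product using (Σ; _,_; proj₁; proj₂)
open import Data.Bool using (true; false)
open import Data.Sum using (inj₁; inj₂)
open import Data.Empty using (⊥-elim)
open import Relation.Nullary.Reflects using (Reflects; ofʸ; ofⁿ; fromEquivalence)
open import Relation.Binary.PropositionalEquality
  using (refl; sym; trans; cong; cong₂; subst₂; module ≡-Reasoning)
  renaming (subst to transport)
open import Relation.Binary.Construct.Closure.ReflexiveTransitive using (ε; _◅_)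

lookup-below : ∀ Δ Γ Γ' i → i < length Δ → lookupD (Δ ++ Γ) i ≡ lookupD (Δ ++ Γ') i
lookup-below (D ∷ Δ) Γ Γ' zero    _       = refl
lookup-below (D ∷ Δ) Γ Γ' (suc i) (s≤s p) = lookup-below Δ Γ Γ' i p

lookup-at : ∀ Δ L Γ → lookupD (Δ ++ L ∷ Γ) (length Δ) ≡ L
lookup-at []      L Γ = refl
lookup-at (D ∷ Δ) L Γ = lookup-at Δ L Γ

lookup-above : ∀ Δ L Γ i → length Δ < i → lookupD (Δ ++ Γ) (pred i) ≡ lookupD (Δ ++ L ∷ Γ) i
lookup-above []      L Γ (suc i) _                = refl
lookup-above (D ∷ Δ) L Γ (suc i) (s≤s p@(s≤s _)) = lookup-above Δ L Γ i p

≡ᵇ-reflects-≡ : ∀ m n → Reflects (m ≡ n) (m ≡ᵇ n)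
≡ᵇ-reflects-≡ m n = fromEquivalence (≡ᵇ⇒≡ m n) (≡⇒≡ᵇ m n)

deg-shift : ∀ M Δ L Γ → deg (Δ ++ L ∷ Γ) (shift (length Δ) M) ≡ deg (Δ ++ Γ) M
deg-shift (bv i) Δ L Γ with i <ᵇ length Δ | <ᵇ-reflects-< i (length Δ)
... | true  | ofʸ i<Δ = lookup-below Δ (L ∷ Γ) Γ i i<Δ
... | false | ofⁿ i≮Δ = sym (lookup-above Δ L Γ (suc i) (s≤s (≮⇒≥ i≮Δ)))
deg-shift (fv x K) Δ L Γ = refl
deg-shift (M · N)  Δ L Γ = deg-shift M Δ L Γ
deg-shift (ƛ K M)  Δ L Γ = deg-shift M (K ∷ Δ) L Γ

deg-subst : ∀ M Δ Γ L N → deg (Δ ++ Γ) N ≡ L →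
  deg (Δ ++ Γ) (subst (length Δ) N M) ≡ deg (Δ ++ L ∷ Γ) M
deg-subst (bv i) Δ Γ L N dN with i <ᵇ length Δ | <ᵇ-reflects-< i (length Δ)
... | true  | ofʸ i<Δ = lookup-below Δ Γ (L ∷ Γ) i i<Δ
... | false | ofⁿ i≮Δ with i ≡ᵇ length Δ | ≡ᵇ-reflects-≡ i (length Δ)
...   | true  | ofʸ refl = trans dN (sym (lookup-at Δ L Γ))
...   | false | ofⁿ i≢Δ = lookup-above Δ L Γ i (≤∧≢⇒< (≮⇒≥ i≮Δ) (λ e → i≢Δ (sym e)))
deg-subst (fv x K) Δ Γ L N dN = refl
deg-subst (M · P)  Δ Γ L N dN = deg-subst M Δ Γ L N dN
deg-subst (ƛ K M)  Δ Γ L N dN =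
  deg-subst M (K ∷ Δ) Γ L (shift 0 N) (trans (deg-shift N [] K (Δ ++ Γ)) dN)

deg-apps : ∀ Γ X Ns → deg Γ (apps X Ns) ≡ deg Γ X
deg-apps Γ X []       = refl
deg-apps Γ X (N ∷ Ns) = deg-apps Γ (X · N) Ns

deg-β : ∀ {Γ M N} → Γ ⊢ M ▷β N → deg Γ M ≡ deg Γ N
deg-β {Γ} (β-red {L = L} {M = M} {N = N} dN) = sym (deg-subst M [] Γ L N dN)
deg-β (β-appˡ s) = deg-β s
deg-β (β-appʳ s) = refl
deg-β (β-lam s)  = deg-β s

deg-η : ∀ {Γ M N} → Γ ⊢ M ▷η N → deg Γ M ≡ deg Γ N
deg-η {Γ} (η-red {L = L} {M = M}) = deg-shift M [] L Γ
deg-η (η-appˡ s) = deg-η s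
deg-η (η-appʳ s) = refl
deg-η (η-lam s)  = deg-η s

deg-h : ∀ {M N} → M ▷h N → deg [] M ≡ deg [] N
deg-h (h-red {L} {M} {N} {Ns} dN) = begin
  deg [] (apps (ƛ L M · N) Ns)    ≡⟨ deg-apps [] (ƛ L M · N) Ns ⟩
  deg (L ∷ []) M                  ≡⟨ sym (deg-subst M [] [] L N dN) ⟩
  deg [] (subst 0 N M)            ≡⟨ sym (deg-apps [] (subst 0 N M) Ns) ⟩
  deg [] (apps (subst 0 N M) Ns)  ∎
  where open ≡-Reasoning

deg-step : ∀ r {M N} → Step r M N → deg [] M ≡ deg [] N
deg-step β  s        = deg-β s
deg-step βη (inj₁ s) = deg-β s
deg-step βη (inj₂ s) = deg-η s
deg-step h  s        = deg-h s

deg-▷* : ∀ r {M N} → r ⊢ M ▷* N → deg [] M ≡ deg [] N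
deg-▷* r ε        = refl
deg-▷* r (s ◅ ss) = trans (deg-step r s) (deg-▷* r ss)

-- Every atom read as 𝓜^∅ is an r-interpretation: 𝓜^∅ is r-saturated by
-- subject reduction for degrees.  This witnesses that interpretations exist.
degree-interp : ∀ 𝒜 r → Interp 𝒜 r
degree-interp 𝒜 r = record
  { I      = λ _ → 𝓜^ []
  ; I⊆𝓜∅   = λ _ _ M∈𝓜 → M∈𝓜
  ; I-sat  = λ _ M N wfM M▷*N (_ , dN) → wfM , trans (deg-▷* r M▷*N) dN
  ; I-neut = λ { _ x _ M (Ns , refl , wfM) → wfM , deg-apps [] (fv x []) Ns }
  }

-- Lifting M^{+i} prepends i to every index; dropping the head index
-- undoes it, so lifting is injective.
unlift : Tm → Tm
unlift (bv n)   = bv n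
unlift (fv x L) = fv x (drop 1 L)
unlift (M · N)  = unlift M · unlift N
unlift (ƛ L M)  = ƛ (drop 1 L) (unlift M)

unlift-lift : ∀ i M → unlift (lift i M) ≡ M
unlift-lift i (bv n)   = refl
unlift-lift i (fv x L) = refl
unlift-lift i (M · N)  = cong₂ _·_ (unlift-lift i M) (unlift-lift i N)
unlift-lift i (ƛ L M)  = cong (ƛ L) (unlift-lift i M)

lift-injective : ∀ i {M N} → lift i M ≡ lift i N → M ≡ N
lift-injective i {M} {N} e = begin
  M                 ≡⟨ sym (unlift-lift i M) ⟩
  unlift (lift i M) ≡⟨ cong unlift e ⟩
  unlift (lift i N) ≡⟨ unlift-lift i N ⟩
  N                 ∎
  where open ≡-Reasoning

fv-lift : ∀ i {M x L} → FV M x L → FV (lift i M) x (i ∷ L)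
fv-lift i fv-var      = fv-var
fv-lift i (fv-appˡ p) = fv-appˡ (fv-lift i p)
fv-lift i (fv-appʳ p) = fv-appʳ (fv-lift i p)
fv-lift i (fv-lam p)  = fv-lam (fv-lift i p)

fv-unlift : ∀ i M {x K} → FV (lift i M) x K → Σ Index λ L → K ≡ i ∷ L × FV M x L
fv-unlift i (fv x L) fv-var = L , refl , fv-var
fv-unlift i (M · N) (fv-appˡ p) with fv-unlift i M p
... | L , K≡iL , q = L , K≡iL , fv-appˡ q
fv-unlift i (M · N) (fv-appʳ p) with fv-unlift i N p
... | L , K≡iL , q = L , K≡iL , fv-appʳ q
fv-unlift i (ƛ K M) (fv-lam p) with fv-unlift i M p
... | L , K≡iL , q = L , K≡iL , fv-lam q

⋄-lift : ∀ i M N → M ⋄ N → lift i M ⋄ lift i N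
⋄-lift i M N M⋄N x L K p q with fv-unlift i M p | fv-unlift i N q
... | L' , refl , p' | K' , refl , q' = cong (i ∷_) (M⋄N x L' K' p' q')

⋄-unlift : ∀ i M N → lift i M ⋄ lift i N → M ⋄ N
⋄-unlift i M N M⋄N x L K p q = ∷-injectiveʳ (M⋄N x _ _ (fv-lift i p) (fv-lift i q))

closed-lift : ∀ i M → Closed M → Closed (lift i M)
closed-lift i M cl x K p with fv-unlift i M p
... | L , _ , q = cl x L q

closed-unlift : ∀ i M → Closed (lift i M) → Closed M
closed-unlift i M cl x L p = cl x (i ∷ L) (fv-lift i p)

lookup-lift : ∀ i Γ n → n < length Γ → lookupD (map (i ∷_) Γ) n ≡ i ∷ lookupD Γ n
lookup-lift i (L ∷ Γ) zero    _       = refl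
lookup-lift i (L ∷ Γ) (suc n) (s≤s p) = lookup-lift i Γ n p

deg-lift : ∀ i Γ M → Wf Γ M → deg (map (i ∷_) Γ) (lift i M) ≡ i ∷ deg Γ M
deg-lift i Γ (bv n)   (wf-bv p)          = lookup-lift i Γ n p
deg-lift i Γ (fv x L) _                  = refl
deg-lift i Γ (M · N)  (wf-app wfM _ _ _) = deg-lift i Γ M wfM
deg-lift i Γ (ƛ L M)  (wf-lam wfM _)     = deg-lift i (L ∷ Γ) M wfM

⪯-cons : ∀ i {L K} → L ⪯ K → (i ∷ L) ⪯ (i ∷ K)
⪯-cons i (L' , e) = L' , cong (i ∷_) e

⪯-uncons : ∀ i {L K} → (i ∷ L) ⪯ (i ∷ K) → L ⪯ K
⪯-uncons i (L' , e) = L' , ∷-injectiveʳ e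

wf-lift : ∀ i Γ M → Wf Γ M → Wf (map (i ∷_) Γ) (lift i M)
wf-lift i Γ (bv n) (wf-bv p) = wf-bv (transport (n <_) (sym (length-map (i ∷_) Γ)) p)
wf-lift i Γ (fv x L) wf-fv = wf-fv
wf-lift i Γ (M · N) (wf-app wfM wfN dM⪯dN M⋄N) =
  wf-app (wf-lift i Γ M wfM) (wf-lift i Γ N wfN)
    (subst₂ _⪯_ (sym (deg-lift i Γ M wfM)) (sym (deg-lift i Γ N wfN)) (⪯-cons i dM⪯dN))
    (⋄-lift i M N M⋄N)
wf-lift i Γ (ƛ L M) (wf-lam wfM dM⪯L) =
  wf-lam (wf-lift i (L ∷ Γ) M wfM)
    (transport (_⪯ (i ∷ L)) (sym (deg-lift i (L ∷ Γ) M wfM)) (⪯-cons i dM⪯L))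

wf-unlift : ∀ i Γ M → Wf (map (i ∷_) Γ) (lift i M) → Wf Γ M
wf-unlift i Γ (bv n) (wf-bv p) = wf-bv (transport (n <_) (length-map (i ∷_) Γ) p)
wf-unlift i Γ (fv x L) _ = wf-fv
wf-unlift i Γ (M · N) (wf-app wfM wfN dM⪯dN M⋄N) =
  wf-app wfM' wfN'
    (⪯-uncons i (subst₂ _⪯_ (deg-lift i Γ M wfM') (deg-lift i Γ N wfN') dM⪯dN))
    (⋄-unlift i M N M⋄N)
  where
  wfM' = wf-unlift i Γ M wfM
  wfN' = wf-unlift i Γ N wfN
wf-unlift i Γ (ƛ L M) (wf-lam wfM dM⪯L) =
  wf-lam wfM' (⪯-uncons i (transport (_⪯ (i ∷ L)) (deg-lift i (L ∷ Γ) M wfM') dM⪯L))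
  where
  wfM' = wf-unlift i (L ∷ Γ) M wfM

⟦⟧-wf : ∀ {𝒜 r} (ℐ : Interp 𝒜 r) U M → ⟦ U ⟧ ℐ M → Wf [] M
⟦⟧-wf ℐ (atom a) M M∈a          = proj₁ (Interp.I⊆𝓜∅ ℐ a M M∈a)
⟦⟧-wf ℐ (U ⇒ T)  M (wfM , _)    = wfM
⟦⟧-wf ℐ (ω L)    M (wfM , _)    = wfM
⟦⟧-wf ℐ (U ⊓ V)  M (M∈U , _)    = ⟦⟧-wf ℐ U M M∈U
⟦⟧-wf ℐ (ē i U)  M (M' , M'∈U , refl) = wf-lift i [] M' (⟦⟧-wf ℐ U M' M'∈U)

apps-snoc : ∀ X Ns N → apps X (Ns ++ N ∷ []) ≡ apps X Ns · N
apps-snoc X []       N = refl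
apps-snoc X (M ∷ Ns) N = apps-snoc (X · M) Ns N

-- Types of 𝕋 contain all well-formed neutral terms x^∅ N₁…Nₖ, x ∈ 𝒱₁:
-- atoms by definition of an interpretation, arrows by induction, since
-- a neutral term applied to a well-formed joinable argument is neutral.
neutral-realises : ∀ {𝒜 r} (ℐ : Interp 𝒜 r) T → IsT T → ∀ x → InV₁ x → ∀ Ns →
  Wf [] (apps (fv x []) Ns) → ⟦ T ⟧ ℐ (apps (fv x []) Ns)
neutral-realises ℐ (atom a) _ x x∈𝒱₁ Ns wf =
  Interp.I-neut ℐ a x x∈𝒱₁ _ (Ns , refl , wf)
neutral-realises ℐ (U ⇒ T) (t-arr _ isT) x x∈𝒱₁ Ns wf = wf , applied
  where
  applied : ∀ N → ⟦ U ⟧ ℐ N → apps (fv x []) Ns ⋄ N → ⟦ T ⟧ ℐ (apps (fv x []) Ns · N)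
  applied N N∈U join = transport (⟦ T ⟧ ℐ) (apps-snoc (fv x []) Ns N)
    (neutral-realises ℐ T isT x x∈𝒱₁ (Ns ++ N ∷ [])
      (transport (Wf []) (sym (apps-snoc (fv x []) Ns N)) wf-applied))
    where
    head⪯N : deg [] (apps (fv x []) Ns) ⪯ deg [] N
    head⪯N = transport (_⪯ deg [] N) (sym (deg-apps [] (fv x []) Ns)) (deg [] N , refl)
    wf-applied : Wf [] (apps (fv x []) Ns · N)
    wf-applied = wf-app wf (⟦⟧-wf ℐ U N N∈U) head⪯N join

dT-𝕋 : ∀ {𝒜} {T : Ty 𝒜} → IsT T → dT T ≡ []
dT-𝕋 (t-atom a)  = refl
dT-𝕋 (t-arr _ _) = refl

variable-realises : ∀ {𝒜 r} (ℐ : Interp 𝒜 r) U → IsU U → ∀ x → InV₁ x → ⟦ U ⟧ ℐ (fv x (dT U))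
variable-realises ℐ T (u-T isT) x x∈𝒱₁ =
  transport (λ L → ⟦ T ⟧ ℐ (fv x L)) (sym (dT-𝕋 isT)) (neutral-realises ℐ T isT x x∈𝒱₁ [] wf-fv)
variable-realises ℐ (ω L) (u-ω L) x x∈𝒱₁ = wf-fv , refl
variable-realises ℐ (U ⊓ V) (u-⊓ isU isV dU≡dV) x x∈𝒱₁ =
  variable-realises ℐ U isU x x∈𝒱₁ ,
  transport (λ L → ⟦ V ⟧ ℐ (fv x L)) (sym dU≡dV) (variable-realises ℐ V isV x x∈𝒱₁)
variable-realises ℐ (ē i U) (u-ē isU) x x∈𝒱₁ =
  fv x (dT U) , variable-realises ℐ U isU x x∈𝒱₁ , refl

-- A bound on the numbers of the 𝒱₁-variables occurring free in a term,
-- so that v₁ (suc (max-v₁ M)) is fresh for M.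
max-v₁ : Tm → ℕ
max-v₁ (bv _)         = 0
max-v₁ (fv (v₁ n) _)  = n
max-v₁ (fv (v₂ _) _)  = 0
max-v₁ (M · N)        = max-v₁ M ⊔ max-v₁ N
max-v₁ (ƛ _ M)        = max-v₁ M

max-v₁-bound : ∀ {M n L} → FV M (v₁ n) L → n ≤ max-v₁ M
max-v₁-bound fv-var = ≤-refl
max-v₁-bound {M · N} (fv-appˡ p) = ≤-trans (max-v₁-bound p) (m≤m⊔n (max-v₁ M) (max-v₁ N))
max-v₁-bound {M · N} (fv-appʳ p) = ≤-trans (max-v₁-bound p) (m≤n⊔m (max-v₁ M) (max-v₁ N))
max-v₁-bound (fv-lam p) = max-v₁-bound p

fresh-⋄ : ∀ M L → M ⋄ fv (v₁ (suc (max-v₁ M))) L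
fresh-⋄ M L x K K' p fv-var = ⊥-elim (n≮n _ (max-v₁-bound p))

realisers-ē : ∀ {𝒜} r i (U : Ty 𝒜) → ([ ē i U ] r) ≐ (([ U ] r) ⁺ i)
realisers-ē {𝒜} r i U = to , from
  where
  to : ∀ {M} → ([ ē i U ] r) M → (([ U ] r) ⁺ i) M
  to {M} (wfM , clM , M∈ēU) with M∈ēU (degree-interp 𝒜 r)
  ... | M' , _ , M≡M'⁺ = M' , (wfM' , clM' , M'∈U) , M≡M'⁺
    where
    wfM' : Wf [] M'
    wfM' = wf-unlift i [] M' (transport (Wf []) M≡M'⁺ wfM)
    clM' : Closed M'
    clM' = closed-unlift i M' (transport Closed M≡M'⁺ clM)
    -- the preimage under lifting does not depend on the interpretation
    M'∈U : ∀ ℐ → ⟦ U ⟧ ℐ M'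
    M'∈U ℐ with M∈ēU ℐ
    ... | M'' , M''∈U , M≡M''⁺ =
      transport (⟦ U ⟧ ℐ) (lift-injective i (trans (sym M≡M''⁺) M≡M'⁺)) M''∈U
  from : ∀ {M} → (([ U ] r) ⁺ i) M → ([ ē i U ] r) M
  from (M' , (wfM' , clM' , M'∈U) , refl) =
    wf-lift i [] M' wfM' , closed-lift i M' clM' , λ ℐ → M' , M'∈U ℐ , refl

realisers-⊓ : ∀ {𝒜} r (U V : Ty 𝒜) → ([ U ⊓ V ] r) ≐ (([ U ] r) ∩ ([ V ] r))
realisers-⊓ r U V = to , from
  where
  to : ∀ {M} → ([ U ⊓ V ] r) M → (([ U ] r) ∩ ([ V ] r)) M
  to (wfM , clM , M∈U⊓V) =
    (wfM , clM , λ ℐ → proj₁ (M∈U⊓V ℐ)) , (wfM , clM , λ ℐ → proj₂ (M∈U⊓V ℐ))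
  from : ∀ {M} → (([ U ] r) ∩ ([ V ] r)) M → ([ U ⊓ V ] r) M
  from ((wfM , clM , M∈U) , (_ , _ , M∈V)) = wfM , clM , λ ℐ → M∈U ℐ , M∈V ℐ

-- Part (3): 𝓘(U) ≀ X for every U ∈ 𝕌 and any X: a fresh variable of
-- degree d(U) is a realiser of U joinable with the given term.
realisers-joinable : ∀ {𝒜 r} (ℐ : Interp 𝒜 r) U → IsU U → ∀ {ℓ} (X : Tm → Set ℓ) → (⟦ U ⟧ ℐ) ≀ X
realisers-joinable ℐ U isU X M _ =
  fv x (dT U) , variable-realises ℐ U isU x (inV₁ _) , fresh-⋄ M (dT U)
  where
  x = v₁ (suc (max-v₁ M))

lemma12 : (𝒜 : Set) (r : Red) →
    (∀ i (U : Ty 𝒜) → IsU U → ([ ē i U ] r) ≐ (([ U ] r) ⁺ i))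
    × (∀ (U V : Ty 𝒜) → IsU U → IsU V → dT U ≡ dT V →
         ([ U ⊓ V ] r) ≐ (([ U ] r) ∩ ([ V ] r)))
    × (∀ (ℐ : Interp 𝒜 r) (U V : Ty 𝒜) → IsU U → IsU V → (⟦ U ⟧ ℐ) ≀ (⟦ V ⟧ ℐ))
lemma12 𝒜 r =
  (λ i U _ → realisers-ē r i U) ,
  (λ U V _ _ _ → realisers-⊓ r U V) ,
  (λ ℐ U V isU _ → realisers-joinable ℐ U isU (⟦ V ⟧ ℐ))
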